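{- Let $X$ be a nonempty set, let $\mathcal{F}$ be a family of subsets of $X$ which is closed under intersections and contains $X$, and let $L$ be a complete lattice. Suppose $L_0\subseteq L$ is such that $(\mathcal{F},\supseteq)\cong(L_0,\leq)$ (with $\leq$ the order of $L$ restricted to $L_0$) and $L_0$ can be embedded into $L$ by $\iota_{(L_0,L)}$-embedding. Then: (i) there exists an $L_0$-fuzzy set $\nu: X\to L_0$ such that $\nu_{L_0}=\mathcal{F}$ and $L_0^{\nu}=L_0$; (ii) $\mu=\iota_{(L_0,L)}\circ\nu$ satisfies both $\mu_L=\mathcal{F}$ and $L^{\mu}=L_0$.
   Context: For a complete lattice $K$, a $K$-fuzzy set on $X$ is a mapping $\mu:X\to K$. For $p\in K$, $\mu_p=\{x\in X\mid \mu(x)\geq p\}$ is the $p$-cut, and $\mu_K=\{\mu_p\mid p\in K\}$. Put $K^{\mu}=\{p\in K\mid p=\bigwedge B \text{ for some } B\subseteq \mu(X)\}$ (infima taken in $K$, $\bigwedge\emptyset$ is the top of $K$). For a sub-poset $M$ of a poset $N$, $\iota_{(M,N)}:M\to N$ is the inclusion map $x\mapsto x$. If $L_1$ is a sub-poset of a complete lattice $L$, "$L_1$ can be embedded into $L$ by $\iota_{(L_1,L)}$-embedding" means that $\iota_{(L_1,L)}$ preserves all infima and the top element: for every $S\subseteq L_1$ the infimum of $S$ in $L_1$ exists and equals its infimum in $L$, and the top of $L_1$ is $1_L$. -}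

module Defs where

open import Level using (Level; suc; _⊔_)
open import Data.Product using (Σ; ∃; _×_; _,_; proj₁)
open import Data.Empty.Polymorphic using (⊥)
open import Data.Unit.Polymorphic using (⊤)
open import Relation.Unary using (Pred; _⊆_; _≐_)
open import Relation.Binary.PropositionalEquality using (_≡_)
open import Relation.Binary.Structures using (IsPartialOrder)

record CompleteLattice (ℓ : Level) : Set (suc ℓ) where
  field
    Carrier        : Set ℓ
    _≤_            : Carrier → Carrier → Set ℓ
    isPartialOrder : IsPartialOrder _≡_ _≤_
    ⋀              : Pred Carrier ℓ → Carrier
    ⋀-lower        : ∀ S s → S s → ⋀ S ≤ s
    ⋀-greatest     : ∀ S q → (∀ s → S s → q ≤ s) → q ≤ ⋀ S

  top : Carrier
  top = ⋀ (λ _ → ⊥)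

module _ {ℓ : Level} (L : CompleteLattice ℓ) where
  open CompleteLattice L

  IsInfIn : Pred Carrier ℓ → Pred Carrier ℓ → Carrier → Set ℓ
  IsInfIn P S m = P m × (∀ s → S s → m ≤ s)
                      × (∀ q → P q → (∀ s → S s → q ≤ s) → q ≤ m)

  IsTopIn : Pred Carrier ℓ → Carrier → Set ℓ
  IsTopIn P t = P t × (∀ q → P q → q ≤ t)

  IotaEmbedding : Pred Carrier ℓ → Set (suc ℓ)
  IotaEmbedding L₁ =
    (∀ (S : Pred Carrier ℓ) → S ⊆ L₁ → Σ Carrier λ m → IsInfIn L₁ S m × m ≡ ⋀ S)
    × IsTopIn L₁ top

  cut : {X : Set ℓ} → (X → Carrier) → Carrier → Pred X ℓ
  cut μ p = λ x → p ≤ μ x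

  -- μ_K = 𝓕 for a fuzzy set valued in the sub-poset K (as families of subsets,
  -- subsets compared extensionally)
  CutsEq : {X : Set ℓ} (K : Pred Carrier ℓ) → (X → Carrier) → Pred (Pred X ℓ) ℓ → Set (suc ℓ)
  CutsEq K μ 𝓕 =
    (∀ p → K p → Σ _ λ A → 𝓕 A × (A ≐ cut μ p))
    × (∀ A → 𝓕 A → Σ Carrier λ p → K p × (A ≐ cut μ p))

  Image : {X : Set ℓ} → (X → Carrier) → Pred Carrier ℓ
  Image {X} μ q = Σ X λ x → μ x ≡ q

  HatIn : {X : Set ℓ} (K : Pred Carrier ℓ) → (X → Carrier) → Pred Carrier (suc ℓ)
  HatIn K μ p = Σ (Pred Carrier ℓ) λ B → B ⊆ Image μ × IsInfIn K B p

  Hat : {X : Set ℓ} → (X → Carrier) → Pred Carrier (suc ℓ)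
  Hat μ p = Σ (Pred Carrier ℓ) λ B → B ⊆ Image μ × p ≡ ⋀ B

⋂ : {ℓ : Level} {X : Set ℓ} {I : Set ℓ} → (I → Pred X ℓ) → Pred X ℓ
⋂ f = λ x → ∀ i → f i x

Whole : {ℓ : Level} (X : Set ℓ) → Pred X ℓ
Whole X = λ _ → ⊤

IntersectionClosed : {ℓ : Level} {X : Set ℓ} → Pred (Pred X ℓ) ℓ → Set (suc ℓ)
IntersectionClosed {ℓ} {X} 𝓕 =
  (∀ (I : Set ℓ) (f : I → Pred X ℓ) → (∀ i → 𝓕 (f i)) → Σ _ λ A → 𝓕 A × (A ≐ ⋂ f))
  × (Σ _ λ A → 𝓕 A × (A ≐ Whole X))

record OrderIso {ℓ : Level} {X : Set ℓ} (L : CompleteLattice ℓ)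
                (𝓕 : Pred (Pred X ℓ) ℓ) (L₀ : Pred (CompleteLattice.Carrier L) ℓ)
                : Set (suc ℓ) where
  open CompleteLattice L
  field
    to       : Σ (Pred X ℓ) 𝓕 → Σ Carrier L₀
    from     : Σ Carrier L₀ → Σ (Pred X ℓ) 𝓕
    from∘to  : ∀ A → proj₁ (from (to A)) ≐ proj₁ A
    to∘from  : ∀ p → proj₁ (to (from p)) ≡ proj₁ p
    mono     : ∀ A B → proj₁ B ⊆ proj₁ A → proj₁ (to A) ≤ proj₁ (to B)
    reflect  : ∀ A B → proj₁ (to A) ≤ proj₁ (to B) → proj₁ B ⊆ proj₁ A

-- Send each x to the image under the isomorphism of the least member of 𝓕
-- containing x, namely ⋂ {A ∈ 𝓕 ∣ x ∈ A}.  For q ∈ L₀ the q-cut of this ν is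
-- then exactly the member of 𝓕 corresponding to q, which gives μ_{L₀} = 𝓕, and
-- each q ∈ L₀ is the infimum of the values of ν above it, which gives
-- L₀^ν = L₀.  Because infima of subsets of L₀ agree in L₀ and in L, every cut
-- of ν at p ∈ L equals its cut at ⋀ {r ∈ L₀ ∣ p ≤ r} ∈ L₀, and L^ν = L₀^ν.
module Submission where

open import Defs
open import Level using (Level)
open import Data.Product using (Σ; _×_; proj₁; proj₂; _,_)
open import Function using (_∘_)
open import Function.Bundles using (_⇔_; mk⇔)
open import Function.Properties.Equivalence using () renaming (trans to ⇔-trans)
open import Relation.Unary using (Pred; _⊆_; _≐_)
open import Relation.Unary.Properties using (≐-sym; ≐-trans)
open import Data.Unit.Polymorphic using (⊤)
open import Relation.Binary.PropositionalEquality using (_≡_; refl; sym; subst; subst₂)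
open import Relation.Binary.Structures using (IsPartialOrder)

module _ {ℓ : Level} (L : CompleteLattice ℓ) where
  open CompleteLattice L
  open IsPartialOrder isPartialOrder using (antisym) renaming (trans to ≤-trans)

  isInfIn-unique : ∀ {P S m n} → IsInfIn L P S m → IsInfIn L P S n → m ≡ n
  isInfIn-unique (Pm , m≤S , m-glb) (Pn , n≤S , n-glb) =
    antisym (n-glb _ Pm m≤S) (m-glb _ Pn n≤S)

  ⋀-isInfIn : ∀ {L₀} → IotaEmbedding L L₀ → ∀ {S} → S ⊆ L₀ → IsInfIn L L₀ S (⋀ S)
  ⋀-isInfIn (infima , _) {S} S⊆L₀ with infima S S⊆L₀
  ... | m , m-inf , m≡⋀S = subst (IsInfIn L _ S) m≡⋀S m-inf

  ⋀-closed : ∀ {L₀} → IotaEmbedding L L₀ → ∀ {S} → S ⊆ L₀ → L₀ (⋀ S)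
  ⋀-closed emb S⊆L₀ = proj₁ (⋀-isInfIn emb S⊆L₀)

  module _ {X : Set ℓ} {K : Pred Carrier ℓ} {μ : X → Carrier}
           (μ∈K : ∀ x → K (μ x)) where

    Above : Pred Carrier ℓ → Carrier → Pred Carrier ℓ
    Above P p q = P q × p ≤ q

    cut-≐-cut-⋀-above : ∀ p → cut L μ p ≐ cut L μ (⋀ (Above K p))
    cut-≐-cut-⋀-above p =
      (λ {x} p≤μx → ⋀-lower (Above K p) (μ x) (μ∈K x , p≤μx)) ,
      (λ ⋀≤μx → ≤-trans (⋀-greatest (Above K p) p (λ _ → proj₂)) ⋀≤μx)

    cutsEq-everywhere : (∀ {S} → S ⊆ K → K (⋀ S)) → ∀ {𝓕} →
      CutsEq L K μ 𝓕 → CutsEq L (λ _ → ⊤) μ 𝓕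
    cutsEq-everywhere K-closed (K-cuts , 𝓕-cuts) =
      (λ p _ → let A , FA , A≐cut = K-cuts _ (K-closed proj₁)
               in A , FA , ≐-trans A≐cut (≐-sym (cut-≐-cut-⋀-above p))) ,
      (λ A FA → let p , _ , A≐cut = 𝓕-cuts A FA in p , _ , A≐cut)

    Image⊆K : Image L μ ⊆ K
    Image⊆K (x , refl) = μ∈K x

    module _ (cut-reflects : ∀ {q r} → K q → K r → cut L μ r ⊆ cut L μ q → q ≤ r)
      where

      isInfIn-image-above : ∀ {p} → K p → IsInfIn L K (Above (Image L μ) p) p
      isInfIn-image-above Kp = Kp , (λ _ → proj₂) ,
        λ q Kq q≤above → cut-reflects Kq Kp
          (λ {x} p≤μx → q≤above (μ x) ((x , refl) , p≤μx))

      hatIn⇔ : ∀ p → HatIn L K μ p ⇔ K p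
      hatIn⇔ p = mk⇔ (λ (_ , _ , Kp , _) → Kp)
        (λ Kp → Above (Image L μ) p , (λ {_} → proj₁) , isInfIn-image-above Kp)

    hat⇔hatIn : IotaEmbedding L K → ∀ p → Hat L μ p ⇔ HatIn L K μ p
    hat⇔hatIn emb p = mk⇔
      (λ (B , B⊆Im , p≡⋀B) →
        B , B⊆Im , subst (IsInfIn L K B) (sym p≡⋀B) (⋀-isInfIn emb (Image⊆K ∘ B⊆Im)))
      (λ (B , B⊆Im , p-inf) →
        B , B⊆Im , isInfIn-unique p-inf (⋀-isInfIn emb (Image⊆K ∘ B⊆Im)))

module LeastMember {ℓ : Level} {X : Set ℓ} {𝓕 : Pred (Pred X ℓ) ℓ}
  (𝓕-⋂ : IntersectionClosed 𝓕)
  {L : CompleteLattice ℓ} {L₀ : Pred (CompleteLattice.Carrier L) ℓ}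
  (iso : OrderIso L 𝓕 L₀) where
  open CompleteLattice L
  open OrderIso iso

  member : (q : Carrier) → L₀ q → Pred X ℓ
  member q Lq = proj₁ (from (q , Lq))

  MembersContaining : X → Set ℓ
  MembersContaining x = Σ Carrier λ q → Σ (L₀ q) λ Lq → member q Lq x

  least : (x : X) → Σ (Pred X ℓ) λ A →
    𝓕 A × (A ≐ ⋂ {I = MembersContaining x} λ (q , Lq , _) → member q Lq)
  least x = proj₁ 𝓕-⋂ _ _ (λ (q , Lq , _) → proj₂ (from (q , Lq)))

  leastMember : X → Σ (Pred X ℓ) 𝓕
  leastMember x = let A , FA , _ = least x in A , FA

  ∈-leastMember : ∀ x → proj₁ (leastMember x) x
  ∈-leastMember x = proj₂ (proj₂ (proj₂ (least x))) (λ (_ , _ , x∈) → x∈)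

  leastMember-⊆ : ∀ {x} q (Lq : L₀ q) → member q Lq x → proj₁ (leastMember x) ⊆ member q Lq
  leastMember-⊆ {x} q Lq x∈ y∈ = proj₁ (proj₂ (proj₂ (least x))) y∈ (q , Lq , x∈)

  ν : X → Σ Carrier L₀
  ν = to ∘ leastMember

  member-≐-cut : ∀ q (Lq : L₀ q) → member q Lq ≐ cut L (proj₁ ∘ ν) q
  member-≐-cut q Lq =
    (λ {x} x∈ → subst (_≤ proj₁ (ν x)) (to∘from (q , Lq))
       (mono (from (q , Lq)) (leastMember x) (leastMember-⊆ q Lq x∈))) ,
    (λ {x} q≤νx → reflect (from (q , Lq)) (leastMember x)
       (subst (_≤ proj₁ (ν x)) (sym (to∘from (q , Lq))) q≤νx) (∈-leastMember x))

  cutsEq : CutsEq L L₀ (proj₁ ∘ ν) 𝓕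
  cutsEq =
    (λ q Lq → member q Lq , proj₂ (from (q , Lq)) , member-≐-cut q Lq) ,
    (λ A FA → let q , Lq = to (A , FA)
              in q , Lq , ≐-trans (≐-sym (from∘to (A , FA))) (member-≐-cut q Lq))

  cut-reflects : ∀ {q r} → L₀ q → L₀ r → cut L (proj₁ ∘ ν) r ⊆ cut L (proj₁ ∘ ν) q → q ≤ r
  cut-reflects {q} {r} Lq Lr cutr⊆cutq =
    subst₂ _≤_ (to∘from (q , Lq)) (to∘from (r , Lr))
      (mono (from (q , Lq)) (from (r , Lr))
        (proj₂ (member-≐-cut q Lq) ∘ cutr⊆cutq ∘ proj₁ (member-≐-cut r Lr)))

lemma5 : {ℓ : Level} (X : Set ℓ) → X → (𝓕 : Pred (Pred X ℓ) ℓ) → IntersectionClosed 𝓕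
    → (L : CompleteLattice ℓ) (L₀ : Pred (CompleteLattice.Carrier L) ℓ)
    → OrderIso L 𝓕 L₀ → IotaEmbedding L L₀
    → Σ (X → Σ (CompleteLattice.Carrier L) L₀) λ ν →
        (CutsEq L L₀ (proj₁ ∘ ν) 𝓕
          × (∀ p → HatIn L L₀ (proj₁ ∘ ν) p ⇔ L₀ p))
        × (CutsEq L (λ _ → ⊤) (proj₁ ∘ ν) 𝓕
          × (∀ p → Hat L (proj₁ ∘ ν) p ⇔ L₀ p))
lemma5 X _ 𝓕 𝓕-⋂ L L₀ iso emb =
  ν , (cutsEq , ν-hatIn⇔) ,
  (cutsEq-everywhere L ν∈L₀ (⋀-closed L emb) cutsEq ,
   λ p → ⇔-trans (hat⇔hatIn L ν∈L₀ emb p) (ν-hatIn⇔ p))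
  where
  open LeastMember 𝓕-⋂ iso
  ν∈L₀ : ∀ x → L₀ (proj₁ (ν x))
  ν∈L₀ = proj₂ ∘ ν
  ν-hatIn⇔ : ∀ p → HatIn L L₀ (proj₁ ∘ ν) p ⇔ L₀ p
  ν-hatIn⇔ = hatIn⇔ L ν∈L₀ cut-reflects
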